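{- Let $k\ge 2$ be an integer and let $F$ be a $(k+2,k)$-free $3$-uniform hypergraph. Then there exists a $(k+2,k)$-free subgraph $F'$ of $F$ that is also $(\ell+1,\ell)$-free for all $\ell\in[2,k-1]$ such that $$e(F)-e(F')\le \frac{1}{6}\left(1-\frac{1}{k}\right)(v(F)-v(F'))\,(v(F)+v(F')+2k).$$
   Context: All hypergraphs are finite with edges forming a set. In a $3$-uniform hypergraph, an $(s,k)$-configuration is a collection of $k$ edges whose union has at most $s$ vertices; a hypergraph is $(s,k)$-free if it contains no $(s,k)$-configuration. $v(\cdot)$ and $e(\cdot)$ denote the numbers of vertices and edges. -}

module Defs where

open import Data.Nat using (ℕ; _≤_)
open import Data.Product using (Σ; _×_)
open import Data.List using (List; length)
open import Data.List.Relation.Unary.All using (All)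
open import Data.List.Relation.Unary.Unique.Propositional using (Unique)
open import Data.List.Membership.Propositional using () renaming (_∈_ to _∈ₗ_)
open import Data.Fin.Subset using (Subset; ∣_∣; ⋃; _⊆_)
open import Relation.Binary.PropositionalEquality using (_≡_)
open import Relation.Nullary using (¬_)

record Hypergraph3 (n : ℕ) : Set where
  field
    edges   : List (Subset n)
    unique  : Unique edges
    uniform : All (λ e → ∣ e ∣ ≡ 3) edges
open Hypergraph3 public

v : ∀ {n} → Hypergraph3 n → ℕ
v {n} _ = n

e : ∀ {n} → Hypergraph3 n → ℕ
e H = length (edges H)

Configuration : ∀ {n} → ℕ → ℕ → List (Subset n) → Set
Configuration {n} s k E =
  Σ (List (Subset n)) λ es →
    All (_∈ₗ E) es × Unique es × length es ≡ k × ∣ ⋃ es ∣ ≤ s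

Free : ∀ {n} → ℕ → ℕ → List (Subset n) → Set
Free s k E = ¬ Configuration s k E

record Subgraph {n : ℕ} (H : Hypergraph3 n) : Set where
  field
    vset     : Subset n
    sedges   : List (Subset n)
    sunique  : Unique sedges
    sub      : All (_∈ₗ edges H) sedges
    inside   : All (_⊆ vset) sedges
open Subgraph public

vs : ∀ {n} {H : Hypergraph3 n} → Subgraph H → ℕ
vs F' = ∣ vset F' ∣

es : ∀ {n} {H : Hypergraph3 n} → Subgraph H → ℕ
es F' = length (sedges F')

-- While some (ℓ + 1, ℓ)-configuration with 2 ≤ ℓ ≤ k − 1 remains, take one, C, with ℓ largest,
-- and delete its m ≤ ℓ + 1 vertices S together with every edge meeting S. An edge outside C
-- meeting S leaves a trace of at most two points outside S. Maximality of ℓ and (k + 2, k)-freeness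
-- make these traces expand (any t of them cover at least t points, a Hall-type condition proved by
-- growing a seed of touching traces), so at most ℓ + ∣ V ∖ S ∣ edges disappear. As m ≥ 4 this is
-- at most (k − 1) m (2 ∣ V ∖ S ∣ + m + 2k) / 6k, and these costs telescope because
-- m (2N + m) = (N + m)² − N².

module Submission where

open import Defs
open import Data.Nat using (ℕ; zero; suc; _+_; _*_; _∸_; _≤_; _<_; z≤n; s≤s; s≤s⁻¹; z<s; _≤?_)
open import Data.Nat.Properties
open import Data.Nat.Tactic.RingSolver using (solve-∀)
open import Data.Bool using (true; false)
open import Data.Fin using (Fin)
open import Data.Vec using ([]; _∷_; _[_]=_)
open _[_]=_
import Data.Vec.Properties as Vec
import Data.Bool.Properties as Bool
open import Data.Product using (Σ; ∃; _×_; _,_; proj₁; proj₂)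
open import Data.Sum using (_⊎_; inj₁; inj₂; [_,_]′)
open import Data.Empty using (⊥; ⊥-elim)
open import Function using (_∘_; id; case_of_)
open import Relation.Nullary using (¬_; Dec; yes; no; ¬?; contradiction)
open import Relation.Nullary.Decidable using (toSum)
open import Relation.Unary using (Decidable)
open import Relation.Binary.PropositionalEquality using (_≡_; _≢_; refl; sym; trans; cong; cong₂; subst; subst₂; module ≡-Reasoning)
open import Data.Fin.Subset hiding (inside) renaming (⊥ to ∅)
open import Data.Fin.Subset.Properties
open import Data.List using (List; []; _∷_; _++_; map; filter; length; take)
open import Data.List.Properties using (length-++; map-++; length-take; filter-notAll)
open import Data.List.Relation.Unary.All as All using (All; []; _∷_)
import Data.List.Relation.Unary.All.Properties as All
open import Data.List.Relation.Unary.Any as Any using (Any; here; there; any?)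
open import Data.List.Relation.Unary.All.Properties using (¬Any⇒All¬)
open import Data.List.Membership.Propositional using (find; lose) renaming (_∈_ to _∈ₗ_)
open import Data.List.Membership.Propositional.Properties
import Data.List.Membership.DecPropositional as DecMembership
open import Data.List.Relation.Binary.Subset.Propositional using () renaming (_⊆_ to _⊆ₗ_)
open import Data.List.Relation.Binary.Disjoint.Propositional using (Disjoint)
open import Data.List.Relation.Unary.Unique.Propositional using (Unique)
open import Data.List.Relation.Unary.AllPairs using ([]; _∷_)
import Data.List.Relation.Unary.Unique.Propositional.Properties as Unique

private variable n : ℕ

∣p∪q∣+∣p∩q∣≡∣p∣+∣q∣ : (p q : Subset n) → ∣ p ∪ q ∣ + ∣ p ∩ q ∣ ≡ ∣ p ∣ + ∣ q ∣
∣p∪q∣+∣p∩q∣≡∣p∣+∣q∣ [] [] = refl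
∣p∪q∣+∣p∩q∣≡∣p∣+∣q∣ (true ∷ p) (true ∷ q) =
  cong suc (trans (+-suc _ _) (trans (cong suc (∣p∪q∣+∣p∩q∣≡∣p∣+∣q∣ p q)) (sym (+-suc _ _))))
∣p∪q∣+∣p∩q∣≡∣p∣+∣q∣ (true ∷ p) (false ∷ q) = cong suc (∣p∪q∣+∣p∩q∣≡∣p∣+∣q∣ p q)
∣p∪q∣+∣p∩q∣≡∣p∣+∣q∣ (false ∷ p) (true ∷ q) = trans (cong suc (∣p∪q∣+∣p∩q∣≡∣p∣+∣q∣ p q)) (sym (+-suc _ _))
∣p∪q∣+∣p∩q∣≡∣p∣+∣q∣ (false ∷ p) (false ∷ q) = ∣p∪q∣+∣p∩q∣≡∣p∣+∣q∣ p q

∣p∪q∣≤∣p∣+∣q∣ : (p q : Subset n) → ∣ p ∪ q ∣ ≤ ∣ p ∣ + ∣ q ∣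
∣p∪q∣≤∣p∣+∣q∣ p q = subst (∣ p ∪ q ∣ ≤_) (∣p∪q∣+∣p∩q∣≡∣p∣+∣q∣ p q) (m≤m+n _ _)

Nonempty⇒∣p∣>0 : {p : Subset n} → Nonempty p → 0 < ∣ p ∣
Nonempty⇒∣p∣>0 {p = p} (x , x∈p) =
  subst (_≤ ∣ p ∣) (∣⁅x⁆∣≡1 x) (p⊆q⇒∣p∣≤∣q∣ λ y∈⁅x⁆ → subst (_∈ p) (sym (x∈⁅y⁆⇒x≡y x y∈⁅x⁆)) x∈p)

Nonempty[p∩q]⇒∣p∪q∣<∣p∣+∣q∣ : (p q : Subset n) → Nonempty (p ∩ q) → ∣ p ∪ q ∣ < ∣ p ∣ + ∣ q ∣
Nonempty[p∩q]⇒∣p∪q∣<∣p∣+∣q∣ p q ne = begin-strict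
  ∣ p ∪ q ∣             ≡⟨ +-identityʳ _ ⟨
  ∣ p ∪ q ∣ + 0         <⟨ +-monoʳ-< ∣ p ∪ q ∣ (Nonempty⇒∣p∣>0 ne) ⟩
  ∣ p ∪ q ∣ + ∣ p ∩ q ∣ ≡⟨ ∣p∪q∣+∣p∩q∣≡∣p∣+∣q∣ p q ⟩
  ∣ p ∣ + ∣ q ∣         ∎
  where open ≤-Reasoning

Empty[p∩q]⇒∣p∣+∣q∣≡∣p∪q∣ : (p q : Subset n) → Empty (p ∩ q) → ∣ p ∣ + ∣ q ∣ ≡ ∣ p ∪ q ∣
Empty[p∩q]⇒∣p∣+∣q∣≡∣p∪q∣ {n} p q empty = begin
  ∣ p ∣ + ∣ q ∣         ≡⟨ ∣p∪q∣+∣p∩q∣≡∣p∣+∣q∣ p q ⟨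
  ∣ p ∪ q ∣ + ∣ p ∩ q ∣ ≡⟨ cong (λ r → ∣ p ∪ q ∣ + ∣ r ∣) (Empty-unique {p = p ∩ q} empty) ⟩
  ∣ p ∪ q ∣ + ∣ ∅ {n} ∣ ≡⟨ cong (∣ p ∪ q ∣ +_) (∣⊥∣≡0 n) ⟩
  ∣ p ∪ q ∣ + 0         ≡⟨ +-identityʳ _ ⟩
  ∣ p ∪ q ∣             ∎
  where open ≡-Reasoning

p⊆q⇒∣q∣≤∣p∣⇒p≡q : {p q : Subset n} → p ⊆ q → ∣ q ∣ ≤ ∣ p ∣ → p ≡ q
p⊆q⇒∣q∣≤∣p∣⇒p≡q {p = []} {[]} _ _ = refl
p⊆q⇒∣q∣≤∣p∣⇒p≡q {p = true ∷ p} {true ∷ q} p⊆q ∣q∣≤∣p∣ =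
  cong (true ∷_) (p⊆q⇒∣q∣≤∣p∣⇒p≡q (drop-∷-⊆ p⊆q) (s≤s⁻¹ ∣q∣≤∣p∣))
p⊆q⇒∣q∣≤∣p∣⇒p≡q {p = true ∷ p} {false ∷ q} p⊆q _ with () ← p⊆q here
p⊆q⇒∣q∣≤∣p∣⇒p≡q {p = false ∷ p} {true ∷ q} p⊆q ∣q∣≤∣p∣ =
  contradiction (p⊆q⇒∣p∣≤∣q∣ (drop-∷-⊆ p⊆q)) (<⇒≱ ∣q∣≤∣p∣)
p⊆q⇒∣q∣≤∣p∣⇒p≡q {p = false ∷ p} {false ∷ q} p⊆q ∣q∣≤∣p∣ =
  cong (false ∷_) (p⊆q⇒∣q∣≤∣p∣⇒p≡q (drop-∷-⊆ p⊆q) ∣q∣≤∣p∣)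

p≢q⇒∣p∣<∣p∪q∣ : {p q : Subset n} → p ≢ q → ∣ p ∣ ≡ ∣ q ∣ → ∣ p ∣ < ∣ p ∪ q ∣
p≢q⇒∣p∣<∣p∪q∣ {p = p} {q} p≢q ∣p∣≡∣q∣ = ≰⇒> λ ∪≤p → p≢q (trans
  (p⊆q⇒∣q∣≤∣p∣⇒p≡q (p⊆p∪q q) ∪≤p)
  (sym (p⊆q⇒∣q∣≤∣p∣⇒p≡q (q⊆p∪q p q) (subst (∣ p ∪ q ∣ ≤_) ∣p∣≡∣q∣ ∪≤p))))

q⊆p⇒∣p∣≡∣p─q∣+∣q∣ : {p q : Subset n} → q ⊆ p → ∣ p ∣ ≡ ∣ p ─ q ∣ + ∣ q ∣
q⊆p⇒∣p∣≡∣p─q∣+∣q∣ {p = []} {[]} _ = refl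
q⊆p⇒∣p∣≡∣p─q∣+∣q∣ {p = true ∷ p} {true ∷ q} q⊆p =
  trans (cong suc (q⊆p⇒∣p∣≡∣p─q∣+∣q∣ (drop-∷-⊆ q⊆p))) (sym (+-suc _ _))
q⊆p⇒∣p∣≡∣p─q∣+∣q∣ {p = false ∷ p} {true ∷ q} q⊆p with () ← q⊆p here
q⊆p⇒∣p∣≡∣p─q∣+∣q∣ {p = true ∷ p} {false ∷ q} q⊆p = cong suc (q⊆p⇒∣p∣≡∣p─q∣+∣q∣ (drop-∷-⊆ q⊆p))
q⊆p⇒∣p∣≡∣p─q∣+∣q∣ {p = false ∷ p} {false ∷ q} q⊆p = q⊆p⇒∣p∣≡∣p─q∣+∣q∣ (drop-∷-⊆ q⊆p)

x∈p─q⇒x∉q : ∀ {x : Fin n} (p q : Subset n) → x ∈ p ─ q → x ∉ q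
x∈p─q⇒x∉q (true ∷ p) (false ∷ q) here ()
x∈p─q⇒x∉q (_ ∷ p) (_ ∷ q) (there x∈p─q) (there x∈q) = x∈p─q⇒x∉q p q x∈p─q x∈q

p⊆q∪[p─q] : (p q : Subset n) → p ⊆ q ∪ (p ─ q)
p⊆q∪[p─q] p q {x} x∈p with x ∈? q
... | yes x∈q = p⊆p∪q (p ─ q) x∈q
... | no x∉q = q⊆p∪q q (p ─ q) (x∈p∧x∉q⇒x∈p─q x∈p x∉q)

∪-lub : {p q r : Subset n} → p ⊆ r → q ⊆ r → p ∪ q ⊆ r
∪-lub {p = p} {q} p⊆r q⊆r x∈p∪q = [ p⊆r , q⊆r ]′ (x∈p∪q⁻ p q x∈p∪q)

x∈⋃⁻ : ∀ {x : Fin n} (ps : List (Subset n)) → x ∈ ⋃ ps → ∃ λ p → p ∈ₗ ps × x ∈ p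
x∈⋃⁻ [] x∈∅ = contradiction x∈∅ ∉⊥
x∈⋃⁻ (p ∷ ps) x∈⋃ with x∈p∪q⁻ p (⋃ ps) x∈⋃
... | inj₁ x∈p = p , here refl , x∈p
... | inj₂ x∈⋃ps with q , q∈ps , x∈q ← x∈⋃⁻ ps x∈⋃ps = q , there q∈ps , x∈q

x∈⋃⁺ : ∀ {x : Fin n} {p ps} → p ∈ₗ ps → x ∈ p → x ∈ ⋃ ps
x∈⋃⁺ (here refl) x∈p = p⊆p∪q _ x∈p
x∈⋃⁺ (there p∈ps) x∈p = q⊆p∪q _ _ (x∈⋃⁺ p∈ps x∈p)

⋃-lub : ∀ {q : Subset n} {ps} → All (_⊆ q) ps → ⋃ ps ⊆ q
⋃-lub {ps = ps} ps⊆q x∈⋃ with p , p∈ps , x∈p ← x∈⋃⁻ ps x∈⋃ = All.lookup ps⊆q p∈ps x∈p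

⋃-mono : ∀ {ps qs : List (Subset n)} → ps ⊆ₗ qs → ⋃ ps ⊆ ⋃ qs
⋃-mono {ps = ps} ps⊆qs x∈⋃ with p , p∈ps , x∈p ← x∈⋃⁻ ps x∈⋃ = x∈⋃⁺ (ps⊆qs p∈ps) x∈p

⋃-++ : (ps qs : List (Subset n)) → ⋃ (ps ++ qs) ≡ ⋃ ps ∪ ⋃ qs
⋃-++ [] qs = sym (∪-identityˡ (⋃ qs))
⋃-++ (p ∷ ps) qs = trans (cong (p ∪_) (⋃-++ ps qs)) (sym (∪-assoc p (⋃ ps) (⋃ qs)))

Unique⇒length-mono : ∀ {A : Set} {xs ys : List A} → Unique xs → xs ⊆ₗ ys → length xs ≤ length ys
Unique⇒length-mono {xs = []} _ _ = z≤n
Unique⇒length-mono {xs = x ∷ xs} {ys} (x∉xs ∷ xs!) x∷xs⊆ys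
  with as , bs , refl ← ∈-∃++ (x∷xs⊆ys (here refl)) = begin
    suc (length xs)               ≤⟨ s≤s (Unique⇒length-mono xs! xs⊆as++bs) ⟩
    suc (length (as ++ bs))       ≡⟨ cong suc (length-++ as) ⟩
    suc (length as + length bs)   ≡⟨ +-suc (length as) (length bs) ⟨
    length as + length (x ∷ bs)   ≡⟨ length-++ as ⟨
    length (as ++ x ∷ bs)         ∎
  where
  open ≤-Reasoning
  xs⊆as++bs : xs ⊆ₗ as ++ bs
  xs⊆as++bs {y} y∈xs with ∈-++⁻ as (x∷xs⊆ys (there y∈xs))
  ... | inj₁ y∈as = ∈-++⁺ˡ y∈as
  ... | inj₂ (here refl) = contradiction refl (All.lookup x∉xs y∈xs)
  ... | inj₂ (there y∈bs) = ∈-++⁺ʳ as y∈bs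

length-filter-∁ : ∀ {A : Set} {P : A → Set} (P? : Decidable P) (xs : List A) →
  length xs ≡ length (filter P? xs) + length (filter (¬? ∘ P?) xs)
length-filter-∁ P? [] = refl
length-filter-∁ P? (x ∷ xs) with P? x
... | yes _ = cong suc (length-filter-∁ P? xs)
... | no _ = trans (cong suc (length-filter-∁ P? xs)) (sym (+-suc _ _))

Unique∧equal-size⇒size<∣⋃∣ : ∀ {s} (C : List (Subset n)) → 2 ≤ length C → Unique C →
  All (λ c → ∣ c ∣ ≡ s) C → s < ∣ ⋃ C ∣
Unique∧equal-size⇒size<∣⋃∣ C@(c₁ ∷ c₂ ∷ _) (s≤s (s≤s _)) ((c₁≢c₂ ∷ _) ∷ _) (∣c₁∣≡s ∷ ∣c₂∣≡s ∷ _) =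
  subst (_< ∣ ⋃ C ∣) ∣c₁∣≡s (<-≤-trans (p≢q⇒∣p∣<∣p∪q∣ c₁≢c₂ (trans ∣c₁∣≡s (sym ∣c₂∣≡s)))
    (p⊆q⇒∣p∣≤∣q∣ (∪-lub (x∈⋃⁺ {ps = C} (here refl)) (x∈⋃⁺ {ps = C} (there (here refl))))))

Disjoint-filterʳ : ∀ {A : Set} {P : A → Set} (P? : Decidable P) {xs ys : List A} →
  Disjoint xs ys → Disjoint xs (filter P? ys)
Disjoint-filterʳ P? {ys = ys} xs#ys (x∈xs , x∈filter) = xs#ys (x∈xs , proj₁ (∈-filter⁻ P? {xs = ys} x∈filter))

choose : ∀ {A : Set} → ℕ → List A → List (List A)
choose zero _ = [] ∷ []
choose (suc j) [] = []
choose (suc j) (x ∷ xs) = map (x ∷_) (choose j xs) ++ choose (suc j) xs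

∈-choose⁻ : ∀ {A : Set} j (xs : List A) {T} → T ∈ₗ choose j xs →
  length T ≡ j × T ⊆ₗ xs × (Unique xs → Unique T)
∈-choose⁻ zero xs (here refl) = refl , (λ ()) , (λ _ → [])
∈-choose⁻ (suc j) (x ∷ xs) T∈ with ∈-++⁻ (map (x ∷_) (choose j xs)) T∈
... | inj₂ T∈′ with ∣T∣≡j , T⊆xs , keeps! ← ∈-choose⁻ (suc j) xs T∈′ =
  ∣T∣≡j , there ∘ T⊆xs , λ { (_ ∷ xs!) → keeps! xs! }
... | inj₁ x∷T∈ with T , T∈′ , refl ← ∈-map⁻ (x ∷_) x∷T∈
                 with ∣T∣≡j , T⊆xs , keeps! ← ∈-choose⁻ j xs T∈′ =
  cong suc ∣T∣≡j ,
  (λ { (here refl) → here refl ; (there y∈T) → there (T⊆xs y∈T) }) ,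
  λ { (x∉xs ∷ xs!) → All.tabulate (All.lookup x∉xs ∘ T⊆xs) ∷ keeps! xs! }

choose-complete : ∀ {A : Set} {P : A → Set} (P? : Decidable P) j (xs : List A) →
  j ≤ length (filter P? xs) → ∃ λ T → T ∈ₗ choose j xs × All P T
choose-complete P? zero xs _ = [] , here refl , []
choose-complete P? (suc j) (x ∷ xs) j<∣filter∣ with P? x
... | yes px with T , T∈ , allP ← choose-complete P? j xs (s≤s⁻¹ j<∣filter∣) =
  x ∷ T , ∈-++⁺ˡ (∈-map⁺ (x ∷_) T∈) , px ∷ allP
... | no _ with T , T∈ , allP ← choose-complete P? (suc j) xs j<∣filter∣ =
  T , ∈-++⁺ʳ (map (x ∷_) (choose j xs)) T∈ , allP

_≟ˢ_ : (p q : Subset n) → Dec (p ≡ q)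
_≟ˢ_ = Vec.≡-dec Bool._≟_

configuration? : (s j : ℕ) (E : List (Subset n)) → Unique E → Dec (Configuration s j E)
configuration? s j E E! with any? (λ T → ∣ ⋃ T ∣ ≤? s) (choose j E)
... | yes found with T , T∈ , ∣⋃T∣≤s ← find found with ∣T∣≡j , T⊆E , keeps! ← ∈-choose⁻ j E T∈ =
  yes (T , All.tabulate T⊆E , keeps! E! , ∣T∣≡j , ∣⋃T∣≤s)
... | no none = no λ (C , C⊆E , C! , ∣C∣≡j , ∣⋃C∣≤s) →
  let j≤∣filter∣ = subst (_≤ length (filter (_∈ₗ? C) E)) ∣C∣≡j
        (Unique⇒length-mono C! λ x∈C → ∈-filter⁺ (_∈ₗ? C) (All.lookup C⊆E x∈C) x∈C)
      T , T∈ , T⊆C = choose-complete (_∈ₗ? C) j E j≤∣filter∣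
  in none (lose T∈ (≤-trans (p⊆q⇒∣p∣≤∣q∣ (⋃-mono (All.lookup T⊆C))) ∣⋃C∣≤s))
  where open DecMembership _≟ˢ_ using () renaming (_∈?_ to _∈ₗ?_)

Configuration-weaken : ∀ {s s′ j} {E E′ : List (Subset n)} → s ≤ s′ → E ⊆ₗ E′ →
  Configuration s j E → Configuration s′ j E′
Configuration-weaken s≤s′ E⊆E′ (C , C⊆E , C! , ∣C∣≡j , ∣⋃C∣≤s) =
  C , All.map E⊆E′ C⊆E , C! , ∣C∣≡j , ≤-trans ∣⋃C∣≤s s≤s′

FreeInRange : ℕ → ℕ → List (Subset n) → Set
FreeInRange t K E = ∀ ℓ → t < ℓ → ℓ ≤ K → Free (ℓ + 1) ℓ E

FreeInRange-extend : ∀ {t K} {E : List (Subset n)} →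
  Free (suc t + 1) (suc t) E → FreeInRange (suc t) K E → FreeInRange t K E
FreeInRange-extend free free⁺ ℓ t<ℓ ℓ≤K with m≤n⇒m<n∨m≡n t<ℓ
... | inj₁ suc-t<ℓ = free⁺ ℓ suc-t<ℓ ℓ≤K
... | inj₂ refl = free

FreeInRange-empty : ∀ K (E : List (Subset n)) → FreeInRange K K E
FreeInRange-empty K E ℓ K<ℓ ℓ≤K = contradiction ℓ≤K (<⇒≱ K<ℓ)

LargestConfigurationIn : ℕ → List (Subset n) → Set
LargestConfigurationIn K E = ∃ λ ℓ → 1 < ℓ × ℓ ≤ K × Configuration (ℓ + 1) ℓ E × FreeInRange ℓ K E

FreeInRange⊎largestConfiguration : ∀ {K} t (E : List (Subset n)) → Unique E → t ≤ K →
  FreeInRange t K E → FreeInRange 1 K E ⊎ LargestConfigurationIn K E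
FreeInRange⊎largestConfiguration zero _ _ _ free⁺ = inj₁ λ ℓ 1<ℓ → free⁺ ℓ (<-trans z<s 1<ℓ)
FreeInRange⊎largestConfiguration (suc zero) _ _ _ free⁺ = inj₁ free⁺
FreeInRange⊎largestConfiguration (suc (suc t)) E E! t≤K free⁺ =
  [ (λ conf → inj₂ (suc (suc t) , s≤s (s≤s z≤n) , t≤K , conf , free⁺))
  , (λ free → FreeInRange⊎largestConfiguration (suc t) E E! (≤-trans (n≤1+n _) t≤K)
                (FreeInRange-extend free free⁺))
  ]′ (toSum (configuration? (suc (suc t) + 1) (suc (suc t)) E E!))

module TraceExpansion {n : ℕ} {A : Set} {P : A → Set} (f : A → Subset n) (J : ℕ)
  (small : ∀ {x} → P x → ∣ f x ∣ ≤ 2)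
  (expands : ∀ T → Unique T → All P T → 1 ≤ length T → length T ≤ J → length T < ∣ ⋃ (map f T) ∣)
  (expandsᴶ : ∀ T → Unique T → All P T → length T ≡ J → suc J < ∣ ⋃ (map f T) ∣)
  where

  U : List A → Subset n
  U T = ⋃ (map f T)

  U-++ : ∀ S T → U (S ++ T) ≡ U S ∪ U T
  U-++ S T = trans (cong ⋃ (map-++ f S T)) (⋃-++ (map f S) (map f T))

  U-mono : ∀ {S T} → S ⊆ₗ T → U S ⊆ U T
  U-mono S⊆T = ⋃-mono λ y∈ → case ∈-map⁻ f y∈ of λ where
    (x , x∈S , refl) → ∈-map⁺ f (S⊆T x∈S)

  y∈U⁻ : ∀ {y} T → y ∈ U T → ∃ λ x → x ∈ₗ T × y ∈ f x
  y∈U⁻ T y∈U with _ , y∈ , y∈fx ← x∈⋃⁻ (map f T) y∈U with x , x∈T , refl ← ∈-map⁻ f y∈ =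
    x , x∈T , y∈fx

  ∣U[x]∣≤2 : ∀ {x} → P x → ∣ U (x ∷ []) ∣ ≤ 2
  ∣U[x]∣≤2 {x} px = subst (λ p → ∣ p ∣ ≤ 2) (sym (∪-identityʳ (f x))) (small px)

  2≤J : ∀ {x} → P x → 2 ≤ J
  2≤J {x} px = ≰⇒> λ J≤1 → case m≤n⇒m<n∨m≡n J≤1 of λ where
    (inj₁ J<1) → n≮0 (subst (suc J <_) (∣⊥∣≡0 n) (expandsᴶ [] [] [] (sym (n<1⇒n≡0 J<1))))
    (inj₂ J≡1) → ≤⇒≯ (∣U[x]∣≤2 px)
                   (subst (_< ∣ U (x ∷ []) ∣) (cong suc J≡1) (expandsᴶ (x ∷ []) ([] ∷ []) (px ∷ []) (sym J≡1)))

  Touches : Subset n → A → Set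
  Touches p x = Nonempty (p ∩ f x)

  touches? : ∀ p → Decidable (Touches p)
  touches? p x = nonempty? (p ∩ f x)

  ∣p∪U∣≤∣p∣+length : ∀ p T → All (Touches p) T → All P T → ∣ p ∪ U T ∣ ≤ ∣ p ∣ + length T
  ∣p∪U∣≤∣p∣+length p [] [] [] = ≤-reflexive (trans (cong ∣_∣ (∪-identityʳ p)) (sym (+-identityʳ _)))
  ∣p∪U∣≤∣p∣+length p (x ∷ T) (touch ∷ touches) (px ∷ pT) = begin
    ∣ p ∪ (f x ∪ U T) ∣     ≡⟨ cong ∣_∣ (∪-assoc p (f x) (U T)) ⟨
    ∣ (p ∪ f x) ∪ U T ∣     ≤⟨ ∣p∪U∣≤∣p∣+length (p ∪ f x) T (All.map widen touches) pT ⟩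
    ∣ p ∪ f x ∣ + length T  ≤⟨ +-monoˡ-≤ (length T) ∣p∪fx∣≤∣p∣+1 ⟩
    ∣ p ∣ + 1 + length T    ≡⟨ +-assoc ∣ p ∣ 1 (length T) ⟩
    ∣ p ∣ + suc (length T)  ∎
    where
    open ≤-Reasoning
    widen : ∀ {y} → Touches p y → Touches (p ∪ f x) y
    widen {y} (z , z∈p∩fy) with z∈p , z∈fy ← x∈p∩q⁻ p (f y) z∈p∩fy =
      z , x∈p∩q⁺ (p⊆p∪q (f x) z∈p , z∈fy)
    ∣p∪fx∣≤∣p∣+1 : ∣ p ∪ f x ∣ ≤ ∣ p ∣ + 1
    ∣p∪fx∣≤∣p∣+1 = s≤s⁻¹ (begin
      suc ∣ p ∪ f x ∣ ≤⟨ Nonempty[p∩q]⇒∣p∪q∣<∣p∣+∣q∣ p (f x) touch ⟩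
      ∣ p ∣ + ∣ f x ∣ ≤⟨ +-monoʳ-≤ ∣ p ∣ (small px) ⟩
      ∣ p ∣ + 2       ≡⟨ +-suc ∣ p ∣ 1 ⟩
      suc (∣ p ∣ + 1) ∎)

  ExpandingUpTo : ℕ → Set
  ExpandingUpTo m = ∀ T → Unique T → All P T → length T ≤ m → length T ≤ ∣ U T ∣

  saturated : ∀ S R → Unique S → All P S → 1 ≤ length S → length S ≤ J →
    All (¬_ ∘ Touches (U S)) R → length R ≤ ∣ U R ∣ → length S + length R ≤ ∣ U (S ++ R) ∣
  saturated S R S! pS 1≤∣S∣ ∣S∣≤J untouched ∣R∣≤∣UR∣ = begin
    length S + length R ≤⟨ +-mono-≤ (<⇒≤ (expands S S! pS 1≤∣S∣ ∣S∣≤J)) ∣R∣≤∣UR∣ ⟩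
    ∣ U S ∣ + ∣ U R ∣    ≡⟨ Empty[p∩q]⇒∣p∣+∣q∣≡∣p∪q∣ (U S) (U R) disjoint ⟩
    ∣ U S ∪ U R ∣        ≡⟨ cong ∣_∣ (U-++ S R) ⟨
    ∣ U (S ++ R) ∣       ∎
    where
    open ≤-Reasoning
    disjoint : Empty (U S ∩ U R)
    disjoint (y , y∈∩) with y∈US , y∈UR ← x∈p∩q⁻ (U S) (U R) y∈∩ with x , x∈R , y∈fx ← y∈U⁻ R y∈UR =
      All.lookup untouched x∈R (y , x∈p∩q⁺ (y∈US , y∈fx))

  -- S together with J − ∣ S ∣ elements touching U S would be J elements on at most J + 1 points.
  overflow-impossible : ∀ S R → Unique S → Unique R → Disjoint S R → All P S → All P R →
    All (Touches (U S)) R → ∣ U S ∣ ≤ suc (length S) → length S ≤ J → J ≤ length S + length R → ⊥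
  overflow-impossible S R S! R! S#R pS pR touching ∣US∣≤ ∣S∣≤J J≤ =
    <-irrefl refl (<-≤-trans (expandsᴶ T T! (All.++⁺ pS (All.take⁺ j pR)) ∣T∣≡J) ∣UT∣≤)
    where
    j = J ∸ length S
    R′ = take j R
    ∣R′∣≡j : length R′ ≡ j
    ∣R′∣≡j = trans (length-take j R) (m≤n⇒m⊓n≡m (m≤n+o⇒m∸n≤o J (length S) J≤))
    T = S ++ R′
    T! : Unique T
    T! = Unique.++⁺ S! (Unique.take⁺ j R!) λ (x∈S , x∈R′) →
      All.lookup (All.take⁺ j (All.tabulate λ x∈R x∈S → S#R (x∈S , x∈R))) x∈R′ x∈S
    ∣T∣≡J : length T ≡ J
    ∣T∣≡J = trans (length-++ S) (trans (cong (length S +_) ∣R′∣≡j) (m+[n∸m]≡n ∣S∣≤J))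
    ∣UT∣≤ : ∣ U T ∣ ≤ suc J
    ∣UT∣≤ = begin
      ∣ U T ∣                    ≡⟨ cong ∣_∣ (U-++ S R′) ⟩
      ∣ U S ∪ U R′ ∣             ≤⟨ ∣p∪U∣≤∣p∣+length (U S) R′ (All.take⁺ j touching) (All.take⁺ j pR) ⟩
      ∣ U S ∣ + length R′        ≤⟨ +-monoˡ-≤ (length R′) ∣US∣≤ ⟩
      suc (length S + length R′) ≡⟨ cong suc (length-++ S) ⟨
      suc (length T)             ≡⟨ cong suc ∣T∣≡J ⟩
      suc J                      ∎
      where open ≤-Reasoning

  -- S is a seed, grown by absorbing the elements of R whose traces touch U S; each absorbed
  -- element adds at most one point, so U S stays within ∣ S ∣ + 1 points, and overflow-impossible
  -- stops the growth before ∣ S ∣ reaches J. Once nothing touches S, S and R split (saturated).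
  grow : ∀ fuel S R → length R < fuel → Unique S → Unique R → Disjoint S R → All P S → All P R →
    1 ≤ length S → length S < J → ∣ U S ∣ ≤ suc (length S) → ExpandingUpTo (length R) →
    length S + length R ≤ ∣ U (S ++ R) ∣
  grow (suc fuel) S R ∣R∣<fuel S! R! S#R pS pR 1≤∣S∣ ∣S∣<J ∣US∣≤ ih with any? (touches? (U S)) R
  ... | no none = saturated S R S! pS 1≤∣S∣ (<⇒≤ ∣S∣<J) (¬Any⇒All¬ R none) (ih R R! pR ≤-refl)
  ... | yes some with J ≤? length S + length (filter (touches? (U S)) R)
  ... | yes J≤ = ⊥-elim (overflow-impossible S _ S! (Unique.filter⁺ _ R!) (Disjoint-filterʳ _ S#R) pS
                   (All.filter⁺ _ pR) (All.all-filter _ R) ∣US∣≤ (<⇒≤ ∣S∣<J) J≤)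
  ... | no J≰ = begin
    length S + length R          ≡⟨ cong (length S +_) (length-filter-∁ (touches? (U S)) R) ⟩
    length S + (∣Tch∣ + ∣Rest∣)  ≡⟨ +-assoc (length S) ∣Tch∣ ∣Rest∣ ⟨
    length S + ∣Tch∣ + ∣Rest∣    ≡⟨ cong (_+ ∣Rest∣) (length-++ S) ⟨
    length S′ + ∣Rest∣           ≤⟨ grow fuel S′ Rest ∣Rest∣<fuel S′! Rest! S′#Rest pS′ pRest
                                      1≤∣S′∣ ∣S′∣<J ∣US′∣≤ ih′ ⟩
    ∣ U (S′ ++ Rest) ∣           ≤⟨ p⊆q⇒∣p∣≤∣q∣ (U-mono S′++Rest⊆S++R) ⟩
    ∣ U (S ++ R) ∣               ∎
    where
    open ≤-Reasoning
    Tch = filter (touches? (U S)) R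
    Rest = filter (¬? ∘ touches? (U S)) R
    ∣Tch∣ = length Tch
    ∣Rest∣ = length Rest
    S′ = S ++ Tch
    Tch⊆R : Tch ⊆ₗ R
    Tch⊆R = proj₁ ∘ ∈-filter⁻ (touches? (U S)) {xs = R}
    Rest⊆R : Rest ⊆ₗ R
    Rest⊆R = proj₁ ∘ ∈-filter⁻ (¬? ∘ touches? (U S)) {xs = R}
    ∣Rest∣<∣R∣ : ∣Rest∣ < length R
    ∣Rest∣<∣R∣ = filter-notAll (¬? ∘ touches? (U S)) R (Any.map (λ touch untouched → untouched touch) some)
    ∣Rest∣<fuel : ∣Rest∣ < fuel
    ∣Rest∣<fuel = <-≤-trans ∣Rest∣<∣R∣ (s≤s⁻¹ ∣R∣<fuel)
    S′! : Unique S′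
    S′! = Unique.++⁺ S! (Unique.filter⁺ _ R!) (Disjoint-filterʳ _ S#R)
    Rest! : Unique Rest
    Rest! = Unique.filter⁺ _ R!
    S′#Rest : Disjoint S′ Rest
    S′#Rest (x∈S′ , x∈Rest) with ∈-++⁻ S x∈S′
    ... | inj₁ x∈S = S#R (x∈S , Rest⊆R x∈Rest)
    ... | inj₂ x∈Tch = proj₂ (∈-filter⁻ (¬? ∘ touches? (U S)) {xs = R} x∈Rest)
                         (proj₂ (∈-filter⁻ (touches? (U S)) {xs = R} x∈Tch))
    pS′ : All P S′
    pS′ = All.++⁺ pS (All.filter⁺ _ pR)
    pRest : All P Rest
    pRest = All.filter⁺ _ pR
    1≤∣S′∣ : 1 ≤ length S′
    1≤∣S′∣ = subst (1 ≤_) (sym (length-++ S)) (≤-trans 1≤∣S∣ (m≤m+n _ _))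
    ∣S′∣<J : length S′ < J
    ∣S′∣<J = subst (_< J) (sym (length-++ S)) (≰⇒> J≰)
    ∣US′∣≤ : ∣ U S′ ∣ ≤ suc (length S′)
    ∣US′∣≤ = begin
      ∣ U S′ ∣               ≡⟨ cong ∣_∣ (U-++ S Tch) ⟩
      ∣ U S ∪ U Tch ∣        ≤⟨ ∣p∪U∣≤∣p∣+length (U S) Tch (All.all-filter _ R) (All.filter⁺ _ pR) ⟩
      ∣ U S ∣ + ∣Tch∣        ≤⟨ +-monoˡ-≤ ∣Tch∣ ∣US∣≤ ⟩
      suc (length S + ∣Tch∣) ≡⟨ cong suc (length-++ S) ⟨
      suc (length S′)        ∎
    ih′ : ExpandingUpTo ∣Rest∣
    ih′ T T! pT ∣T∣≤ = ih T T! pT (≤-trans ∣T∣≤ (<⇒≤ ∣Rest∣<∣R∣))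
    S′++Rest⊆S++R : S′ ++ Rest ⊆ₗ S ++ R
    S′++Rest⊆S++R x∈ with ∈-++⁻ S′ x∈
    ... | inj₂ x∈Rest = ∈-++⁺ʳ S (Rest⊆R x∈Rest)
    ... | inj₁ x∈S′ with ∈-++⁻ S x∈S′
    ...   | inj₁ x∈S = ∈-++⁺ˡ x∈S
    ...   | inj₂ x∈Tch = ∈-++⁺ʳ S (Tch⊆R x∈Tch)

  expandingUpTo : ∀ m → ExpandingUpTo m
  expandingUpTo _ [] _ _ _ = z≤n
  expandingUpTo (suc m) (x ∷ T) (x∉T ∷ T!) (px ∷ pT) (s≤s ∣T∣≤m) =
    grow (suc (length T)) (x ∷ []) T ≤-refl ([] ∷ []) T! (λ { (here refl , x∈T) → All.lookup x∉T x∈T refl })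
      (px ∷ []) pT ≤-refl (2≤J px) (∣U[x]∣≤2 px)
      λ T′ T′! pT′ ∣T′∣≤ → expandingUpTo m T′ T′! pT′ (≤-trans ∣T′∣≤ ∣T∣≤m)

  expanding : ∀ T → Unique T → All P T → length T ≤ ∣ U T ∣
  expanding T T! pT = expandingUpTo (length T) T T! pT ≤-refl

telescope-≡ : ∀ c m {N N′} → N′ ≤ N →
  m * (2 * N + m + c) + (N ∸ N′) * (N + N′ + c) ≡ (N + m ∸ N′) * (N + m + N′ + c)
telescope-≡ c m {N} {N′} N′≤N = begin
  m * (2 * N + m + c) + (N ∸ N′) * (N + N′ + c)
    ≡⟨ cong (λ x → m * (2 * x + m + c) + a * (x + N′ + c)) N≡a+N′ ⟩
  m * (2 * (a + N′) + m + c) + a * (a + N′ + N′ + c)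
    ≡⟨ expand a N′ m c ⟩
  (a + m) * (a + N′ + m + N′ + c)
    ≡⟨ cong₂ (λ x y → x * (y + N′ + c)) (+-∸-comm m N′≤N) (cong (_+ m) N≡a+N′) ⟨
  (N + m ∸ N′) * (N + m + N′ + c)
    ∎
  where
  open ≡-Reasoning
  a = N ∸ N′
  N≡a+N′ : N ≡ a + N′
  N≡a+N′ = sym (m∸n+n≡m N′≤N)
  expand : ∀ a b m c → m * (2 * (a + b) + m + c) + a * (a + b + b + c) ≡ (a + m) * (a + b + m + b + c)
  expand = solve-∀

telescope-≤ : ∀ c d K m r e₁ e′ {N N′} → N′ ≤ N →
  c * r ≤ K * m * (2 * N + m + d) →
  c * e₁ ≤ c * e′ + K * (N ∸ N′) * (N + N′ + d) →
  c * (r + e₁) ≤ c * e′ + K * (N + m ∸ N′) * (N + m + N′ + d)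
telescope-≤ c d K m r e₁ e′ {N} {N′} N′≤N cr≤ ce₁≤ = begin
  c * (r + e₁)
    ≡⟨ *-distribˡ-+ c r e₁ ⟩
  c * r + c * e₁
    ≤⟨ +-mono-≤ cr≤ ce₁≤ ⟩
  K * m * (2 * N + m + d) + (c * e′ + K * (N ∸ N′) * (N + N′ + d))
    ≡⟨ factor K m (N ∸ N′) (c * e′) (2 * N + m + d) (N + N′ + d) ⟩
  c * e′ + K * (m * (2 * N + m + d) + (N ∸ N′) * (N + N′ + d))
    ≡⟨ cong (λ x → c * e′ + K * x) (telescope-≡ d m N′≤N) ⟩
  c * e′ + K * ((N + m ∸ N′) * (N + m + N′ + d))
    ≡⟨ cong (c * e′ +_) (*-assoc K _ _) ⟨
  c * e′ + K * (N + m ∸ N′) * (N + m + N′ + d)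
    ∎
  where
  open ≤-Reasoning
  factor : ∀ K m a z x y → K * m * x + (z + K * a * y) ≡ z + K * (m * x + a * y)
  factor = solve-∀

removal-cost : ∀ k ℓ m N r → 4 ≤ m → 4 ≤ k → ℓ ≤ k ∸ 1 → r ≤ ℓ + N →
  6 * k * r ≤ (k ∸ 1) * m * (2 * N + m + 2 * k)
removal-cost k@(suc (suc (suc (suc t)))) ℓ m N r 4≤m (s≤s (s≤s (s≤s (s≤s _)))) ℓ≤k-1 r≤ℓ+N = begin
  6 * k * r                                   ≤⟨ *-monoʳ-≤ (6 * k) (≤-trans r≤ℓ+N (+-monoˡ-≤ N ℓ≤k-1)) ⟩
  6 * k * (3 + t + N)                         ≤⟨ m≤m+n _ _ ⟩
  6 * k * (3 + t + N) + slack                 ≡⟨ expand t N ⟨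
  (3 + t) * 4 * (2 * N + 4 + 2 * k)           ≤⟨ *-mono-≤ (*-monoʳ-≤ (3 + t) 4≤m)
                                                            (+-monoˡ-≤ (2 * k) (+-monoʳ-≤ (2 * N) 4≤m)) ⟩
  (3 + t) * m * (2 * N + m + 2 * k)           ∎
  where
  open ≤-Reasoning
  slack = 72 + 30 * t + 2 * t * t + 2 * t * N
  expand : ∀ t N → (3 + t) * 4 * (2 * N + 4 + 2 * (4 + t)) ≡
    6 * (4 + t) * (3 + t + N) + (72 + 30 * t + 2 * t * t + 2 * t * N)
  expand = solve-∀

module Peeling {n : ℕ} (k : ℕ) (F : Hypergraph3 n) (F-free : Free (k + 2) k (edges F)) where

  record Peeled (G : Subgraph F) : Set where
    field
      rest       : Subgraph F
      m r        : ℕ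
      vs-split   : vs G ≡ vs rest + m
      es-split   : es G ≡ r + es rest
      shrinks    : vs rest < vs G
      cost       : 6 * k * r ≤ (k ∸ 1) * m * (2 * vs rest + m + 2 * k)

  module Peel (G : Subgraph F) (ℓ : ℕ) (1<ℓ : 1 < ℓ) (ℓ≤k-1 : ℓ ≤ k ∸ 1)
    (C : List (Subset n)) (C⊆E : All (_∈ₗ sedges G) C) (C! : Unique C) (∣C∣≡ℓ : length C ≡ ℓ)
    (∣⋃C∣≤ℓ+1 : ∣ ⋃ C ∣ ≤ ℓ + 1) (free⁺ : FreeInRange ℓ (k ∸ 1) (sedges G)) where

    open DecMembership (_≟ˢ_ {n}) using () renaming (_∈?_ to _∈ₗ?_)

    V = vset G
    E = sedges G
    S = ⋃ C

    E-free : Free (k + 2) k E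
    E-free = F-free ∘ Configuration-weaken ≤-refl (All.lookup (sub G))

    ∣e∣≡3 : ∀ {x} → x ∈ₗ E → ∣ x ∣ ≡ 3
    ∣e∣≡3 x∈E = All.lookup (uniform F) (All.lookup (sub G) x∈E)

    ℓ≤k : ℓ ≤ k
    ℓ≤k = ≤-trans ℓ≤k-1 (m∸n≤m k 1)

    ℓ+1≤k : ℓ + 1 ≤ k
    ℓ+1≤k = m≤o∸n⇒m+n≤o ℓ (≤-trans (<⇒≤ 1<ℓ) ℓ≤k) ℓ≤k-1

    Meets : Subset n → Set
    Meets x = Nonempty (x ∩ S)

    meets? : Decidable Meets
    meets? x = nonempty? (x ∩ S)

    Attached : Subset n → Set
    Attached x = x ∈ₗ E × Meets x × ¬ x ∈ₗ C

    trace : Subset n → Subset n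
    trace x = x ─ S

    U : List (Subset n) → Subset n
    U T = ⋃ (map trace T)

    ∣trace∣≤2 : ∀ {x} → Attached x → ∣ trace x ∣ ≤ 2
    ∣trace∣≤2 {x} (x∈E , meets , _) = s≤s⁻¹ (subst (∣ x ─ S ∣ <_) (∣e∣≡3 x∈E) (p∩q≢∅⇒∣p─q∣<∣p∣ x S meets))

    C++T : ∀ T → Unique T → All Attached T → Configuration (∣ S ∣ + ∣ U T ∣) (ℓ + length T) E
    C++T T T! att = C ++ T
      , All.++⁺ C⊆E (All.map proj₁ att)
      , Unique.++⁺ C! T! (λ (x∈C , x∈T) → proj₂ (proj₂ (All.lookup att x∈T)) x∈C)
      , trans (length-++ C) (cong (_+ length T) ∣C∣≡ℓ)
      , (begin
          ∣ ⋃ (C ++ T) ∣    ≡⟨ cong ∣_∣ (⋃-++ C T) ⟩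
          ∣ S ∪ ⋃ T ∣       ≤⟨ p⊆q⇒∣p∣≤∣q∣ (∪-lub (p⊆p∪q (U T)) (⋃-lub (All.tabulate split))) ⟩
          ∣ S ∪ U T ∣       ≤⟨ ∣p∪q∣≤∣p∣+∣q∣ S (U T) ⟩
          ∣ S ∣ + ∣ U T ∣   ∎)
      where
      open ≤-Reasoning
      split : ∀ {x} → x ∈ₗ T → x ⊆ S ∪ U T
      split {x} x∈T y∈x with x∈p∪q⁻ S (trace x) (p⊆q∪[p─q] x S y∈x)
      ... | inj₁ y∈S = p⊆p∪q (U T) y∈S
      ... | inj₂ y∈tx = q⊆p∪q S (U T) (x∈⋃⁺ (∈-map⁺ trace x∈T) y∈tx)

    J = k ∸ ℓ

    C++T-bound : ∀ T → Unique T → All Attached T → ∀ {s} → ∣ U T ∣ ≤ s →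
      Configuration (ℓ + 1 + s) (ℓ + length T) E
    C++T-bound T T! att ∣UT∣≤s = Configuration-weaken (+-mono-≤ ∣⋃C∣≤ℓ+1 ∣UT∣≤s) id (C++T T T! att)

    -- C ++ T has ℓ + ∣ T ∣ edges on ℓ + ∣ T ∣ + 1 points: this contradicts the maximality of ℓ,
    -- or (k + 2, k)-freeness if ℓ + ∣ T ∣ = k.
    expands : ∀ T → Unique T → All Attached T → 1 ≤ length T → length T ≤ J → length T < ∣ U T ∣
    expands T T! att 1≤∣T∣ ∣T∣≤J = ≰⇒> λ ∣UT∣≤∣T∣ → case ℓ + length T ≤? k ∸ 1 of λ
      { (yes ≤k-1) → free⁺ (ℓ + length T) (m<m+n ℓ 1≤∣T∣) ≤k-1
          (Configuration-weaken (≤-reflexive (swap ℓ (length T))) id (C++T-bound T T! att ∣UT∣≤∣T∣))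
      ; (no ≰k-1) → E-free (subst (λ j → Configuration (k + 2) j E)
          (≤-antisym ≤k (≤-trans (m≤n+m∸n k 1) (≰⇒> ≰k-1)))
          (Configuration-weaken (≤-trans (≤-reflexive (swap ℓ (length T))) (+-mono-≤ ≤k (n≤1+n 1))) id
            (C++T-bound T T! att ∣UT∣≤∣T∣)))
      }
      where
      ≤k : ℓ + length T ≤ k
      ≤k = subst (ℓ + length T ≤_) (m+[n∸m]≡n ℓ≤k) (+-monoʳ-≤ ℓ ∣T∣≤J)
      swap : ∀ a b → a + 1 + b ≡ a + b + 1
      swap = solve-∀

    expandsᴶ : ∀ T → Unique T → All Attached T → length T ≡ J → suc J < ∣ U T ∣
    expandsᴶ T T! att ∣T∣≡J = ≰⇒> λ ∣UT∣≤1+J →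
      E-free (subst₂ (λ s j → Configuration s j E) (trans (s≡ ℓ J) (cong (_+ 2) (m+[n∸m]≡n ℓ≤k))) ℓ+∣T∣≡k
        (C++T-bound T T! att ∣UT∣≤1+J))
      where
      ℓ+∣T∣≡k : ℓ + length T ≡ k
      ℓ+∣T∣≡k = trans (cong (ℓ +_) ∣T∣≡J) (m+[n∸m]≡n ℓ≤k)
      s≡ : ∀ ℓ J → ℓ + 1 + suc J ≡ ℓ + J + 2
      s≡ = solve-∀

    open TraceExpansion trace J ∣trace∣≤2 expands expandsᴶ using (expanding)

    Hit = filter meets? E
    Kept = filter (¬? ∘ meets?) E
    HitC = filter (_∈ₗ? C) Hit
    Hitᶜ = filter (¬? ∘ (_∈ₗ? C)) Hit

    Hit! : Unique Hit
    Hit! = Unique.filter⁺ meets? (sunique G)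

    Hitᶜ-attached : All Attached Hitᶜ
    Hitᶜ-attached = All.tabulate λ x∈Hitᶜ →
      let x∈Hit , x∉C = ∈-filter⁻ (¬? ∘ (_∈ₗ? C)) {xs = Hit} x∈Hitᶜ
          x∈E , meets = ∈-filter⁻ meets? {xs = E} x∈Hit
      in x∈E , meets , x∉C

    U⊆V─S : ∀ T → All Attached T → U T ⊆ V ─ S
    U⊆V─S T att y∈UT with _ , y∈ , y∈tx ← x∈⋃⁻ (map trace T) y∈UT with x , x∈T , refl ← ∈-map⁻ trace y∈ =
      x∈p∧x∉q⇒x∈p─q (All.lookup (inside G) (proj₁ (All.lookup att x∈T)) (p─q⊆p x S y∈tx)) (x∈p─q⇒x∉q x S y∈tx)

    ∣HitC∣≤ℓ : length HitC ≤ ℓ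
    ∣HitC∣≤ℓ = subst (length HitC ≤_) ∣C∣≡ℓ
      (Unique⇒length-mono (Unique.filter⁺ (_∈ₗ? C) Hit!) (proj₂ ∘ ∈-filter⁻ (_∈ₗ? C) {xs = Hit}))

    ∣Hitᶜ∣≤∣V─S∣ : length Hitᶜ ≤ ∣ V ─ S ∣
    ∣Hitᶜ∣≤∣V─S∣ = ≤-trans (expanding Hitᶜ (Unique.filter⁺ _ Hit!) Hitᶜ-attached)
                           (p⊆q⇒∣p∣≤∣q∣ (U⊆V─S Hitᶜ Hitᶜ-attached))

    ∣Hit∣≤ℓ+∣V─S∣ : length Hit ≤ ℓ + ∣ V ─ S ∣
    ∣Hit∣≤ℓ+∣V─S∣ = subst (_≤ ℓ + ∣ V ─ S ∣) (sym (length-filter-∁ (_∈ₗ? C) Hit)) (+-mono-≤ ∣HitC∣≤ℓ ∣Hitᶜ∣≤∣V─S∣)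

    S⊆V : S ⊆ V
    S⊆V = ⋃-lub (All.map (All.lookup (inside G)) C⊆E)

    4≤∣S∣ : 4 ≤ ∣ S ∣
    4≤∣S∣ = Unique∧equal-size⇒size<∣⋃∣ C (subst (2 ≤_) (sym ∣C∣≡ℓ) 1<ℓ) C! (All.map ∣e∣≡3 C⊆E)

    rest : Subgraph F
    rest = record
      { vset = V ─ S
      ; sedges = Kept
      ; sunique = Unique.filter⁺ _ (sunique G)
      ; sub = All.filter⁺ _ (sub G)
      ; inside = All.tabulate λ x∈Kept y∈x →
          let x∈E , misses = ∈-filter⁻ (¬? ∘ meets?) {xs = E} x∈Kept
          in x∈p∧x∉q⇒x∈p─q (All.lookup (inside G) x∈E y∈x) λ y∈S → misses (_ , x∈p∩q⁺ (y∈x , y∈S))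
      }

    peeled : Peeled G
    peeled = record
      { rest = rest
      ; m = ∣ S ∣
      ; r = length Hit
      ; vs-split = vs-split
      ; es-split = length-filter-∁ meets? E
      ; shrinks = subst (∣ V ─ S ∣ <_) (sym vs-split) (m<m+n ∣ V ─ S ∣ (<-≤-trans z<s 4≤∣S∣))
      ; cost = removal-cost k ℓ ∣ S ∣ ∣ V ─ S ∣ (length Hit) 4≤∣S∣ (≤-trans 4≤∣S∣ (≤-trans ∣⋃C∣≤ℓ+1 ℓ+1≤k))
                 ℓ≤k-1 ∣Hit∣≤ℓ+∣V─S∣
      }
      where
      vs-split : ∣ V ∣ ≡ ∣ V ─ S ∣ + ∣ S ∣
      vs-split = q⊆p⇒∣p∣≡∣p─q∣+∣q∣ S⊆V

  Reduced : Subgraph F → Set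
  Reduced G = Σ (Subgraph F) λ F′ → FreeInRange 1 (k ∸ 1) (sedges F′) × vs F′ ≤ vs G
    × (6 * k * es G ≤ 6 * k * es F′ + (k ∸ 1) * (vs G ∸ vs F′) * (vs G + vs F′ + 2 * k))

  Peeled⇒Reduced : ∀ {G} (p : Peeled G) → Reduced (Peeled.rest p) → Reduced G
  Peeled⇒Reduced {G} p (F′ , sparse , vs≤ , bound) =
    F′ , sparse , ≤-trans vs≤ (subst (vs rest ≤_) (sym vs-split) (m≤m+n _ _)) ,
    subst₂ (λ e N → 6 * k * e ≤ 6 * k * es F′ + (k ∸ 1) * (N ∸ vs F′) * (N + vs F′ + 2 * k))
      (sym es-split) (sym vs-split) (telescope-≤ (6 * k) (2 * k) (k ∸ 1) m r (es rest) (es F′) vs≤ cost bound)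
    where open Peeled p

  reduce : ∀ fuel (G : Subgraph F) → vs G < fuel → Reduced G
  reduce (suc fuel) G vs<fuel with FreeInRange⊎largestConfiguration (k ∸ 1) (sedges G) (sunique G) ≤-refl
                                      (FreeInRange-empty (k ∸ 1) (sedges G))
  ... | inj₁ sparse = G , sparse , ≤-refl , m≤m+n _ _
  ... | inj₂ (ℓ , 1<ℓ , ℓ≤k-1 , (C , C⊆E , C! , ∣C∣≡ℓ , ∣⋃C∣≤ℓ+1) , free⁺) =
    Peeled⇒Reduced peeled (reduce fuel (Peeled.rest peeled) (<-≤-trans (Peeled.shrinks peeled) (s≤s⁻¹ vs<fuel)))
    where open Peel G ℓ 1<ℓ ℓ≤k-1 C C⊆E C! ∣C∣≡ℓ ∣⋃C∣≤ℓ+1 free⁺ using (peeled)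

lemma2p3 : (k : ℕ) → 2 ≤ k → {n : ℕ} → (F : Hypergraph3 n) → Free (k + 2) k (edges F) →
    Σ (Subgraph F) λ F' →
      Free (k + 2) k (sedges F')
      × ((ℓ : ℕ) → 2 ≤ ℓ → ℓ ≤ k ∸ 1 → Free (ℓ + 1) ℓ (sedges F'))
      × (6 * k * e F ≤ 6 * k * es F' + (k ∸ 1) * (v F ∸ vs F') * (v F + vs F' + 2 * k))
lemma2p3 k _ {n} F F-free =
  let F′ , sparse , _ , bound = reduce (suc n) whole (s≤s (≤-reflexive (∣⊤∣≡n n)))
  in F′ , F-free ∘ Configuration-weaken ≤-refl (All.lookup (sub F′)) , sparse ,
     subst (λ N → 6 * k * e F ≤ 6 * k * es F′ + (k ∸ 1) * (N ∸ vs F′) * (N + vs F′ + 2 * k)) (∣⊤∣≡n n) bound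
  where
  open Peeling k F F-free
  whole : Subgraph F
  whole = record
    { vset = ⊤ ; sedges = edges F ; sunique = unique F ; sub = All.tabulate id ; inside = All.tabulate λ _ _ → ∈⊤ }
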